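{- Let $N>2t^2+t$. In any execution of Algorithm B, for any identifier $id$ of a correct process and any two correct processes $p,q$, $|\text{newid}_p[id]-\text{newid}_q[id]|\le 2t^2$.
   Context: System model: $N$ processes in a fully connected synchronous message-passing network with reliable channels; a receiver knows the label of the link on which a message arrived but not the sender's identifier; each correct process has a unique identifier initially known only to itself; up to $t$ processes are Byzantine (arbitrary behavior). "Broadcast" means send to all $N$ links (including a self-loop). Algorithm B (each correct process): Step 1: broadcast $\langle ID, my\_id\rangle$; for each $\langle ID,id\rangle$ received on link $lnk$ set linkid$[lnk]:=id$ and add $id$ to the set timely (linkid$[lnk]=\perp$ for links with no ID message). Step 2: broadcast $\langle MULTIECHO,\text{timely}\rangle$; for each $\langle MULTIECHO, ids\rangle$ received on link $lnk$, if linkid$[lnk]\ne\perp$, $|ids|\le N$ and $|\text{timely}\cap ids|\ge N-t$, then for each $id\in ids$ add $id$ to accepted and increment counter$[id]$ (initially $0$). Then, for each $id\in$ accepted, newid$[id]:=\sum_{id''\in \text{accepted},\, id''\le id}\min(\text{counter}[id''],N-t)$; output newid$[my\_id]$. -}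

module Defs where

open import Data.Bool using (Bool; true; false; not; _∧_; if_then_else_; T)
open import Data.Nat using (ℕ; _≤_; _<_; _≡ᵇ_; _≤ᵇ_; _∸_; _⊓_)
open import Data.Fin using (Fin)
open import Data.Maybe using (Maybe; just; nothing)
open import Data.List using (List; []; _∷_; length; filterᵇ; allFin; map; concatMap; mapMaybe; deduplicateᵇ)
open import Data.Bool.ListAction using (any)
open import Data.Nat.ListAction using (sum)
open import Data.List.Relation.Unary.Unique.Propositional using (Unique)
open import Relation.Binary.PropositionalEquality using (_≡_)
open import Function.Definitions using (Injective)

ID : Set
ID = ℕ

_∈ᵇ_ : ID → List ID → Bool
x ∈ᵇ xs = any (x ≡ᵇ_) xs

-- An execution of Algorithm B with N processes (named Fin N from the
-- outside; these names are NOT known to the processes) and at most t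
-- Byzantine processes.  Byzantine behaviour is arbitrary: since we quantify
-- over all functions byzID / byzME, every (possibly adaptive, equivocating)
-- behaviour of the faulty processes in this deterministic algorithm is covered.
record Execution (N t : ℕ) : Set where
  field
    correct      : Fin N → Bool
    few-faulty   : length (filterᵇ (λ p → not (correct p)) (allFin N)) ≤ t
    -- identifier of each process (only meaningful for correct processes)
    myid         : Fin N → ID
    ids-unique   : ∀ p q → T (correct p) → T (correct q) → myid p ≡ myid q → p ≡ q
    -- link p l : the process at the other end of link l of process p;
    -- every process has exactly one link to every process (incl. itself).
    link         : Fin N → Fin N → Fin N
    link-inj     : ∀ p → Injective _≡_ _≡_ (link p)
    -- Byzantine sender q, message (at most one per link per round) to receiver p:
    byzID        : Fin N → Fin N → Maybe ID               -- step 1: ⟨ID, id⟩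
    byzME        : Fin N → Fin N → Maybe (List ID)        -- step 2: ⟨MULTIECHO, ids⟩
    byzME-set    : ∀ q p ids → byzME q p ≡ just ids → Unique ids

module AlgorithmB {N t : ℕ} (E : Execution N t) where
  open Execution E

  -- Step 1: message received by p on link l (linkid[l]; nothing = ⊥).
  linkid : Fin N → Fin N → Maybe ID
  linkid p l with correct (link p l)
  ... | true  = just (myid (link p l))
  ... | false = byzID (link p l) p

  timely : Fin N → List ID
  timely p = deduplicateᵇ _≡ᵇ_ (mapMaybe (linkid p) (allFin N))

  received : Fin N → Fin N → Maybe (List ID)
  received p l with correct (link p l)
  ... | true  = just (timely (link p l))
  ... | false = byzME (link p l) p

  inter : List ID → List ID → ℕ
  inter tm ids = length (filterᵇ (_∈ᵇ tm) ids)

  isDefined : Maybe ID → Bool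
  isDefined (just _) = true
  isDefined nothing  = false

  acceptMsg : Fin N → Fin N → List ID → Bool
  acceptMsg p l ids = isDefined (linkid p l) ∧ (length ids ≤ᵇ N) ∧ ((N ∸ t) ≤ᵇ inter (timely p) ids)

  acceptedMsg : Fin N → Fin N → Maybe (List ID)
  acceptedMsg p l with received p l
  ... | nothing  = nothing
  ... | just ids = if acceptMsg p l ids then just ids else nothing

  acceptedMsgs : Fin N → List (List ID)
  acceptedMsgs p = mapMaybe (acceptedMsg p) (allFin N)

  accepted : Fin N → List ID
  accepted p = deduplicateᵇ _≡ᵇ_ (concatMap (λ ids → ids) (acceptedMsgs p))

  counter : Fin N → ID → ℕ
  counter p x = length (filterᵇ (x ∈ᵇ_) (acceptedMsgs p))

  newid : Fin N → ID → ℕ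
  newid p x = sum (map (λ y → counter p y ⊓ (N ∸ t)) (filterᵇ (_≤ᵇ x) (accepted p)))

module Submission where

open import Defs
open import Data.Bool using (T)
open import Data.Nat using (ℕ; _<_; _≤_; _+_; _*_; ∣_-_∣)
open import Data.Fin using (Fin)
open import Data.Product using (∃)
open import Relation.Binary.PropositionalEquality using (_≡_)

open import Algebra.Properties.CommutativeSemigroup using (interchange)
open import Data.Bool using (Bool; true; false; not)
open import Data.Bool.Properties using (T-∧)
open import Data.Empty using (⊥-elim)
open import Data.Fin using (punchOut)
open import Data.Fin.Properties using (any?; punchOut-injective; injective⇒≤) renaming (_≟_ to _≟ᶠ_)
open import Data.List using (List; []; _∷_; length; map; filter; filterᵇ; mapMaybe; concatMap; allFin; deduplicate; deduplicateᵇ)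
open import Data.List.Properties using (map-∘; filter-≐; length-map; length-tabulate; length-mapMaybe; length-deduplicate)
open import Data.List.Membership.Propositional using (_∈_; _∉_)
open import Data.List.Membership.Propositional.Properties
  using (∈-allFin; ∈-map⁺; ∈-map⁻; ∈-filter⁺; ∈-filter⁻; ∈-concatMap⁺; ∈-deduplicate⁺; ∈-deduplicate⁻)
open import Data.List.Relation.Unary.All as All using ()
import Data.List.Relation.Unary.All.Properties as AllP
open import Data.List.Relation.Unary.Any as Any using (here; there)
open import Data.List.Relation.Unary.Any.Properties using (any⁺; any⁻; mapMaybe⁺; map⁺)
open import Data.List.Relation.Unary.Unique.Propositional using (Unique; []; _∷_)
import Data.List.Relation.Unary.Unique.Propositional.Properties as Unique
open import Data.List.Relation.Unary.Unique.DecPropositional.Properties using (deduplicate-!)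
open import Data.Maybe using (Maybe; just; nothing; maybe)
open import Data.Maybe.Properties using (just-injective)
import Data.Maybe.Relation.Unary.Any as MAny
open import Data.Nat using (suc; _∸_; _⊓_; _≡ᵇ_; _≤ᵇ_; _≟_; z≤n)
open import Data.Nat.ListAction using (sum)
open import Data.Nat.Properties
  using (module ≤-Reasoning; ≤-refl; ≤-trans; ≤-reflexive; ≤-antisym; ≤-total; 1+n≰n;
         +-comm; +-identityʳ; +-commutativeSemigroup; +-mono-≤; +-monoʳ-≤; +-monoˡ-≤; +-cancelʳ-≤;
         *-monoˡ-≤; *-distribˡ-+; ∸-monoʳ-≤; m+n∸n≡m; m≤m+n; m≤n+m; m≤n+m∸n; m≤n+o⇒m∸n≤o;
         m⊓n≤m; m⊓n≤n; m≤n⇒m⊓n≡m; m≥n⇒m⊓n≡n; ⊓-monoˡ-≤; ∣m-n∣≡[m∸n]∨[n∸m]; ≡ᵇ⇒≡; ≡⇒≡ᵇ; ≤ᵇ⇒≤; ≤⇒≤ᵇ)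
open import Data.List.Membership.DecPropositional _≟_ using (_∈?_)
open import Data.Product using (_×_; _,_; proj₁; proj₂)
open import Data.Sum using (_⊎_; inj₁; inj₂)
open import Function using (_∘_; _∘₂_; Equivalence)
open import Function.Definitions using (Injective)
open import Relation.Binary.Definitions using (DecidableEquality)
open import Relation.Binary.PropositionalEquality
open import Relation.Nullary using (¬_; yes; no)
open import Relation.Nullary.Decidable using (T?; ⌊_⌋; fromWitness; fromWitnessFalse)

-- Messages of correct processes are accepted by everybody, so the
-- counter splits as  correctEchoes y + faultyEchoes p y , where the first term does
-- not depend on p.  If y belongs to a correct process, every correct process has it
-- in its timely set, so correctEchoes y ≥ N - t and both p and q truncate counter[y]
-- to exactly N - t.  For any other y, truncation at N - t moves p's summand by at most
-- faultyEchoes p y above q's.  Summing over the identifiers ≤ x accepted by p, these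
-- excesses are bounded link by link: a Byzantine link carries one accepted message,
-- which holds at most t untimely identifiers (it overlaps timely in N - t of at most
-- N entries) and at most t timely non-correct ones (each link yields one timely
-- identifier); with at most t Byzantine links the total excess is at most 2t².
-- Hence newid_p[x] ≤ newid_q[x] + 2t² for all processes p, q and every x.

when : Bool → ℕ → ℕ
when true  n = n
when false _ = 0

𝟙 : Bool → ℕ
𝟙 b = when b 1

when≤ : ∀ b n → when b n ≤ n
when≤ true  n = ≤-refl
when≤ false n = z≤n

when-T : ∀ {b} n → T b → when b n ≡ n
when-T {true} n _ = refl

when-¬T : ∀ {b} n → ¬ T b → when b n ≡ 0
when-¬T {true}  n ¬b = ⊥-elim (¬b _)
when-¬T {false} n ¬b = refl

when-zero : ∀ b → when b 0 ≡ 0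
when-zero true  = refl
when-zero false = refl

when-cong : ∀ b {m n} → (T b → m ≡ n) → when b m ≡ when b n
when-cong true  m≡n = m≡n _
when-cong false m≡n = refl

when-monoʳ : ∀ b {m n} → m ≤ n → when b m ≤ when b n
when-monoʳ true  m≤n = m≤n
when-monoʳ false m≤n = z≤n

when-comm : ∀ a b n → when a (when b n) ≡ when b (when a n)
when-comm true  b n = refl
when-comm false b n = sym (when-zero b)

when-split : ∀ b n → when b n + when (not b) n ≡ n
when-split true  n = +-identityʳ n
when-split false n = refl

𝟙-not : ∀ {b} → T b → 𝟙 (not b) ≡ 0
𝟙-not {true} _ = refl

maybe-𝟙≤1 : ∀ {a} {A : Set a} (P : A → Bool) (m : Maybe A) → maybe (𝟙 ∘ P) 0 m ≤ 1
maybe-𝟙≤1 P (just x) = when≤ (P x) 1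
maybe-𝟙≤1 P nothing  = z≤n

∑ : ∀ {a} {A : Set a} → List A → (A → ℕ) → ℕ
∑ xs f = sum (map f xs)

syntax ∑ xs (λ x → e) = ∑[ x ∈ xs ] e

module _ {a} {A : Set a} where

  ∑-+ : ∀ (xs : List A) (f g : A → ℕ) → ∑[ x ∈ xs ] (f x + g x) ≡ ∑ xs f + ∑ xs g
  ∑-+ []       f g = refl
  ∑-+ (x ∷ xs) f g = begin
    (f x + g x) + ∑[ y ∈ xs ] (f y + g y) ≡⟨ cong (f x + g x +_) (∑-+ xs f g) ⟩
    (f x + g x) + (∑ xs f + ∑ xs g)     ≡⟨ interchange +-commutativeSemigroup (f x) (g x) (∑ xs f) (∑ xs g) ⟩
    (f x + ∑ xs f) + (g x + ∑ xs g)     ∎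
    where open ≡-Reasoning

  ∑-mono : ∀ (xs : List A) {f g : A → ℕ} → (∀ x → f x ≤ g x) → ∑ xs f ≤ ∑ xs g
  ∑-mono []       f≤g = z≤n
  ∑-mono (x ∷ xs) f≤g = +-mono-≤ (f≤g x) (∑-mono xs f≤g)

  ∑-cong : ∀ (xs : List A) {f g : A → ℕ} → (∀ {x} → x ∈ xs → f x ≡ g x) → ∑ xs f ≡ ∑ xs g
  ∑-cong []       f≡g = refl
  ∑-cong (x ∷ xs) f≡g = cong₂ _+_ (f≡g (here refl)) (∑-cong xs (f≡g ∘ there))

  ∑-zero : ∀ (xs : List A) {f : A → ℕ} → (∀ {x} → x ∈ xs → f x ≡ 0) → ∑ xs f ≡ 0
  ∑-zero []       f≡0 = refl
  ∑-zero (x ∷ xs) f≡0 = cong₂ _+_ (f≡0 (here refl)) (∑-zero xs (f≡0 ∘ there))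

  ∑-member≤ : ∀ (f : A → ℕ) {x} {xs : List A} → x ∈ xs → f x ≤ ∑ xs f
  ∑-member≤ f {xs = y ∷ xs} (here refl) = m≤m+n (f y) (∑ xs f)
  ∑-member≤ f {xs = y ∷ xs} (there x∈xs) = ≤-trans (∑-member≤ f x∈xs) (m≤n+m (∑ xs f) (f y))

  ∑-when : ∀ b (xs : List A) (f : A → ℕ) → when b (∑ xs f) ≡ ∑[ x ∈ xs ] when b (f x)
  ∑-when true  xs f = refl
  ∑-when false xs f = sym (∑-zero xs (λ _ → refl))

  ∑-split : ∀ (P : A → Bool) (xs : List A) (f : A → ℕ) →
            ∑ xs f ≡ ∑[ x ∈ xs ] when (P x) (f x) + ∑[ x ∈ xs ] when (not (P x)) (f x)
  ∑-split P xs f = trans (∑-cong xs (λ {x} _ → sym (when-split (P x) (f x)))) (∑-+ xs _ _)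

  ∑-when-const : ∀ (P : A → Bool) k (xs : List A) → ∑[ x ∈ xs ] when (P x) k ≡ ∑ xs (𝟙 ∘ P) * k
  ∑-when-const P k []       = refl
  ∑-when-const P k (x ∷ xs) with P x
  ... | true  = cong (k +_) (∑-when-const P k xs)
  ... | false = ∑-when-const P k xs

  length-∑ : ∀ (xs : List A) → length xs ≡ ∑[ _ ∈ xs ] 1
  length-∑ []       = refl
  length-∑ (x ∷ xs) = cong suc (length-∑ xs)

  count-∑ : ∀ (P : A → Bool) (xs : List A) → length (filterᵇ P xs) ≡ ∑ xs (𝟙 ∘ P)
  count-∑ P []       = refl
  count-∑ P (x ∷ xs) with P x
  ... | true  = cong suc (count-∑ P xs)
  ... | false = count-∑ P xs

  count-complement : ∀ (P : A → Bool) (xs : List A) → ∑ xs (𝟙 ∘ P) + ∑ xs (𝟙 ∘ not ∘ P) ≡ length xs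
  count-complement P xs = trans (sym (∑-split P xs (λ _ → 1))) (sym (length-∑ xs))

  ∑-⊆ : DecidableEquality A → ∀ (f : A → ℕ) {L K : List A} → Unique L →
        (∀ {y} → y ∈ L → f y ≡ 0 ⊎ y ∈ K) → ∑ L f ≤ ∑ K f
  ∑-⊆ _≟_ f {[]}    _          _    = z≤n
  ∑-⊆ _≟_ f {y ∷ L} {K} (y∉L ∷ L!) supp with supp (here refl)
  ... | inj₁ fy≡0 rewrite fy≡0 = ∑-⊆ _≟_ f L! (supp ∘ there)
  ... | inj₂ y∈K = begin
    f y + ∑ L f                 ≡⟨ cong (f y +_) (∑-cong L (λ z∈L → sym (when-T _ (y≢ z∈L)))) ⟩
    f y + ∑ L other             ≡⟨ cong (_+ ∑ L other) (sym (when-T (f y) (fromWitness refl))) ⟩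
    atY y + ∑ L other           ≤⟨ +-mono-≤ (∑-member≤ atY y∈K) (∑-⊆ _≟_ other L! supp-other) ⟩
    ∑ K atY + ∑ K other         ≡⟨ sym (∑-split (λ z → ⌊ y ≟ z ⌋) K f) ⟩
    ∑ K f                       ∎
    where
    open ≤-Reasoning
    atY other : A → ℕ
    atY   z = when ⌊ y ≟ z ⌋ (f z)
    other z = when (not ⌊ y ≟ z ⌋) (f z)
    y≢ : ∀ {z} → z ∈ L → T (not ⌊ y ≟ z ⌋)
    y≢ z∈L = fromWitnessFalse (All.lookup y∉L z∈L)
    supp-other : ∀ {z} → z ∈ L → other z ≡ 0 ⊎ z ∈ K
    supp-other {z} z∈L with supp (there z∈L)
    ... | inj₁ fz≡0 = inj₁ (trans (cong (when _) fz≡0) (when-zero _))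
    ... | inj₂ z∈K  = inj₂ z∈K

module _ {a b} {A : Set a} {B : Set b} where

  ∑-map : ∀ (g : A → B) (f : B → ℕ) (xs : List A) → ∑ (map g xs) f ≡ ∑[ x ∈ xs ] f (g x)
  ∑-map g f xs = cong sum (sym (map-∘ xs))

  ∑-mapMaybe : ∀ (g : A → Maybe B) (f : B → ℕ) (xs : List A) →
               ∑ (mapMaybe g xs) f ≡ ∑[ x ∈ xs ] maybe f 0 (g x)
  ∑-mapMaybe g f []       = refl
  ∑-mapMaybe g f (x ∷ xs) with g x
  ... | just y  = cong (f y +_) (∑-mapMaybe g f xs)
  ... | nothing = ∑-mapMaybe g f xs

  ∑-swap-when : ∀ (P : A → Bool) (Q : B → Bool) (h : A → B → ℕ) (xs : List A) (ys : List B) →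
                ∑[ x ∈ xs ] when (P x) (∑[ y ∈ ys ] when (Q y) (h x y)) ≡
                ∑[ y ∈ ys ] when (Q y) (∑[ x ∈ xs ] when (P x) (h x y))
  ∑-swap-when P Q h []       ys = sym (∑-zero ys (λ {y} _ → when-zero (Q y)))
  ∑-swap-when P Q h (x ∷ xs) ys = begin
    when (P x) (∑[ y ∈ ys ] when (Q y) (h x y)) + ∑[ x′ ∈ xs ] when (P x′) (∑[ y ∈ ys ] when (Q y) (h x′ y))
      ≡⟨ cong₂ _+_ (∑-when (P x) ys _) (∑-swap-when P Q h xs ys) ⟩
    ∑[ y ∈ ys ] when (P x) (when (Q y) (h x y)) + ∑[ y ∈ ys ] when (Q y) (column y)
      ≡⟨ ∑-+ ys _ _ ⟨
    ∑[ y ∈ ys ] (when (P x) (when (Q y) (h x y)) + when (Q y) (column y))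
      ≡⟨ ∑-cong ys (λ {y} _ → merge y) ⟩
    ∑[ y ∈ ys ] when (Q y) (when (P x) (h x y) + column y) ∎
    where
    open ≡-Reasoning
    column : B → ℕ
    column y = ∑[ x′ ∈ xs ] when (P x′) (h x′ y)
    merge : ∀ y → when (P x) (when (Q y) (h x y)) + when (Q y) (column y) ≡ when (Q y) (when (P x) (h x y) + column y)
    merge y with Q y
    ... | true  = refl
    ... | false = trans (+-identityʳ _) (when-zero (P x))

∈-mapMaybe⁺ : ∀ {a b} {A : Set a} {B : Set b} (g : A → Maybe B) {x y} {xs : List A} →
              x ∈ xs → g x ≡ just y → y ∈ mapMaybe g xs
∈-mapMaybe⁺ g {xs = xs} x∈xs gx≡y =
  mapMaybe⁺ g xs (map⁺ (Any.map (λ { refl → subst (MAny.Any _) (sym gx≡y) (MAny.just refl) }) x∈xs))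

injective⇒surjective : ∀ {n} (π : Fin n → Fin n) → Injective _≡_ _≡_ π → ∀ w → ∃ λ l → π l ≡ w
injective⇒surjective {suc n} π π-inj w with any? (λ l → π l ≟ᶠ w)
... | yes hit = hit
... | no  miss = ⊥-elim (1+n≰n (injective⇒≤ avoid-inj))
  where
  w≢ : ∀ l → w ≢ π l
  w≢ l w≡πl = miss (l , sym w≡πl)
  -- π misses w, so it factors injectively through Fin n
  avoid : Fin (suc n) → Fin n
  avoid l = punchOut (w≢ l)
  avoid-inj : Injective _≡_ _≡_ avoid
  avoid-inj eq = π-inj (punchOut-injective (w≢ _) (w≢ _) eq)

∑-reindex : ∀ {n} (π : Fin n → Fin n) → Injective _≡_ _≡_ π → ∀ (f : Fin n → ℕ) →
            ∑[ i ∈ allFin n ] f (π i) ≡ ∑ (allFin n) f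
∑-reindex {n} π π-inj f = trans (sym (∑-map π f (allFin n))) (≤-antisym image≤all all≤image)
  where
  image! : Unique (map π (allFin n))
  image! = Unique.map⁺ π-inj (Unique.allFin⁺ n)
  image≤all : ∑ (map π (allFin n)) f ≤ ∑ (allFin n) f
  image≤all = ∑-⊆ _≟ᶠ_ f image! (λ {y} _ → inj₂ (∈-allFin y))
  all≤image : ∑ (allFin n) f ≤ ∑ (map π (allFin n)) f
  all≤image = ∑-⊆ _≟ᶠ_ f (Unique.allFin⁺ n) λ {y} _ →
    let (l , πl≡y) = injective⇒surjective π π-inj y in inj₂ (subst (_∈ _) πl≡y (∈-map⁺ π (∈-allFin l)))

map⁺-injectiveOn : ∀ {a b} {A : Set a} {B : Set b} (g : A → B) {xs : List A} → Unique xs →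
                   (∀ {x y} → x ∈ xs → y ∈ xs → g x ≡ g y → x ≡ y) → Unique (map g xs)
map⁺-injectiveOn g []         inj = []
map⁺-injectiveOn g (x∉xs ∷ xs!) inj =
  AllP.map⁺ (All.tabulate λ y∈xs gx≡gy → All.lookup x∉xs y∈xs (inj (here refl) (there y∈xs) gx≡gy))
  ∷ map⁺-injectiveOn g xs! (λ x∈ y∈ → inj (there x∈) (there y∈))

∈ᵇ⇒∈ : ∀ {x} xs → T (x ∈ᵇ xs) → x ∈ xs
∈ᵇ⇒∈ {x} xs x∈ᵇxs = Any.map (≡ᵇ⇒≡ x _) (any⁻ _ xs x∈ᵇxs)

∈⇒∈ᵇ : ∀ {x xs} → x ∈ xs → T (x ∈ᵇ xs)
∈⇒∈ᵇ {x} x∈xs = any⁺ _ (Any.map (λ { refl → ≡⇒≡ᵇ x x refl }) x∈xs)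

deduplicateᵇ≡deduplicate : ∀ xs → deduplicateᵇ _≡ᵇ_ xs ≡ deduplicate _≟_ xs
deduplicateᵇ≡deduplicate []       = refl
deduplicateᵇ≡deduplicate (x ∷ xs) = cong (x ∷_) (trans
  (filter-≐ _ _ ((λ x≢ → x≢ ∘ ≡⇒≡ᵇ x _) , (λ x≢ → x≢ ∘ ≡ᵇ⇒≡ x _)) (deduplicateᵇ _≡ᵇ_ xs))
  (cong (filter _) (deduplicateᵇ≡deduplicate xs)))

deduplicateᵇ-unique : ∀ xs → Unique (deduplicateᵇ _≡ᵇ_ xs)
deduplicateᵇ-unique xs = subst Unique (sym (deduplicateᵇ≡deduplicate xs)) (deduplicate-! _≟_ xs)

∈-deduplicateᵇ⁺ : ∀ {x xs} → x ∈ xs → x ∈ deduplicateᵇ _≡ᵇ_ xs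
∈-deduplicateᵇ⁺ {xs = xs} x∈xs = subst (_ ∈_) (sym (deduplicateᵇ≡deduplicate xs)) (∈-deduplicate⁺ _≟_ x∈xs)

∑-deduplicateᵇ≤ : ∀ (f : ID → ℕ) xs → ∑ (deduplicateᵇ _≡ᵇ_ xs) f ≤ ∑ xs f
∑-deduplicateᵇ≤ f xs = ∑-⊆ _≟_ f (deduplicateᵇ-unique xs) (inj₂ ∘ ∈-deduplicate⁻ _ xs)

∑-∩≤ : ∀ (P : ID → Bool) ids {S} → Unique S → ∑[ y ∈ S ] when (P y) (𝟙 (y ∈ᵇ ids)) ≤ ∑ ids (𝟙 ∘ P)
∑-∩≤ P ids {S} S! = begin
  ∑ S f      ≤⟨ ∑-⊆ _≟_ f S! supp ⟩
  ∑ ids f    ≡⟨ ∑-cong ids (λ y∈ → cong (when (P _)) (when-T 1 (∈⇒∈ᵇ y∈))) ⟩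
  ∑ ids (𝟙 ∘ P) ∎
  where
  open ≤-Reasoning
  f : ID → ℕ
  f y = when (P y) (𝟙 (y ∈ᵇ ids))
  supp : ∀ {y} → y ∈ S → f y ≡ 0 ⊎ y ∈ ids
  supp {y} _ with y ∈? ids
  ... | yes y∈ = inj₂ y∈
  ... | no  y∉ = inj₁ (trans (cong (when (P y)) (when-¬T 1 (y∉ ∘ ∈ᵇ⇒∈ ids))) (when-zero (P y)))

⊓-shift : ∀ a b c m → (a + b) ⊓ m ≤ (a + c) ⊓ m + b
⊓-shift a b c m with ≤-total a m
... | inj₁ a≤m = begin
  (a + b) ⊓ m  ≤⟨ m⊓n≤m (a + b) m ⟩
  a + b        ≡⟨ cong (_+ b) (sym (m≤n⇒m⊓n≡m a≤m)) ⟩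
  a ⊓ m + b    ≤⟨ +-monoˡ-≤ b (⊓-monoˡ-≤ m (m≤m+n a c)) ⟩
  (a + c) ⊓ m + b ∎
  where open ≤-Reasoning
... | inj₂ m≤a = begin
  (a + b) ⊓ m  ≤⟨ m⊓n≤n (a + b) m ⟩
  m            ≡⟨ sym (m≥n⇒m⊓n≡n (≤-trans m≤a (m≤m+n a c))) ⟩
  (a + c) ⊓ m  ≤⟨ m≤m+n _ b ⟩
  (a + c) ⊓ m + b ∎
  where open ≤-Reasoning

complement≤ : ∀ {a b n N} t → a + b ≡ n → n ≤ N → N ∸ t ≤ a → b ≤ t
complement≤ {a} {b} {n} {N} t a+b≡n n≤N N∸t≤a = +-cancelʳ-≤ (N ∸ t) b t (begin
  b + (N ∸ t)  ≤⟨ +-monoʳ-≤ b N∸t≤a ⟩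
  b + a        ≡⟨ trans (+-comm b a) a+b≡n ⟩
  n            ≤⟨ n≤N ⟩
  N            ≤⟨ m≤n+m∸n N t ⟩
  t + (N ∸ t)  ∎)
  where open ≤-Reasoning

∣-∣≤ : ∀ {a b k} → a ≤ b + k → b ≤ a + k → ∣ a - b ∣ ≤ k
∣-∣≤ {a} {b} a≤b+k b≤a+k with ∣m-n∣≡[m∸n]∨[n∸m] a b
... | inj₁ ∣a-b∣≡a∸b = subst (_≤ _) (sym ∣a-b∣≡a∸b) (m≤n+o⇒m∸n≤o a b a≤b+k)
... | inj₂ ∣a-b∣≡b∸a = subst (_≤ _) (sym ∣a-b∣≡b∸a) (m≤n+o⇒m∸n≤o b a b≤a+k)

module Analysis {N t : ℕ} (E : Execution N t) where
  open Execution E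
  open AlgorithmB E

  M : ℕ
  M = N ∸ t

  faulty-count : ∑ (allFin N) (𝟙 ∘ not ∘ correct) ≤ t
  faulty-count = subst (_≤ t) (count-∑ (not ∘ correct) (allFin N)) few-faulty

  correct-count : M ≤ ∑ (allFin N) (𝟙 ∘ correct)
  correct-count = begin
    N ∸ t                   ≤⟨ ∸-monoʳ-≤ N faulty-count ⟩
    N ∸ #faulty             ≡⟨ cong (_∸ #faulty) N≡ ⟩
    #correct + #faulty ∸ #faulty ≡⟨ m+n∸n≡m #correct #faulty ⟩
    #correct ∎
    where
    open ≤-Reasoning
    #correct #faulty : ℕ
    #correct = ∑ (allFin N) (𝟙 ∘ correct)
    #faulty  = ∑ (allFin N) (𝟙 ∘ not ∘ correct)
    N≡ : N ≡ #correct + #faulty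
    N≡ = trans (sym (length-tabulate (λ i → i))) (sym (count-complement correct (allFin N)))

  ∑-links : ∀ p (f : Fin N → ℕ) → ∑[ l ∈ allFin N ] f (link p l) ≡ ∑ (allFin N) f
  ∑-links p = ∑-reindex (link p) (link-inj p)

  linkid-correct : ∀ p l → T (correct (link p l)) → linkid p l ≡ just (myid (link p l))
  linkid-correct p l _ with correct (link p l)
  ... | true = refl

  received-correct : ∀ p l → T (correct (link p l)) → received p l ≡ just (timely (link p l))
  received-correct p l _ with correct (link p l)
  ... | true = refl

  -- Messages from correct processes are duplicate-free by construction, those of
  -- Byzantine processes by the model; so every received MULTIECHO is a set.
  received-set : ∀ p l {ids} → received p l ≡ just ids → Unique ids
  received-set p l {ids} eq with correct (link p l)
  ... | true  = subst Unique (just-injective eq) (deduplicateᵇ-unique _)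
  ... | false = byzME-set (link p l) p ids eq

  correctIds : List ID
  correctIds = map myid (filterᵇ correct (allFin N))

  isCorrectId : ID → Bool
  isCorrectId y = y ∈ᵇ correctIds

  filtered-correct : ∀ {w} → w ∈ filterᵇ correct (allFin N) → T (correct w)
  filtered-correct w∈ = proj₂ (∈-filter⁻ (T? ∘ correct) {xs = allFin N} w∈)

  correctIds-unique : Unique correctIds
  correctIds-unique = map⁺-injectiveOn myid (Unique.filter⁺ (T? ∘ correct) (Unique.allFin⁺ N))
    λ v∈ w∈ → ids-unique _ _ (filtered-correct v∈) (filtered-correct w∈)

  correctIds-length : M ≤ length correctIds
  correctIds-length = subst (M ≤_)
    (sym (trans (length-map myid (filterᵇ correct (allFin N))) (count-∑ correct (allFin N))))
    correct-count

  correctId⁺ : ∀ w → T (correct w) → T (isCorrectId (myid w))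
  correctId⁺ w c = ∈⇒∈ᵇ (∈-map⁺ myid (∈-filter⁺ (T? ∘ correct) (∈-allFin w) c))

  correct-timely : ∀ w → T (correct w) → ∀ p → myid w ∈ timely p
  correct-timely w c p with injective⇒surjective (link p) (link-inj p) w
  ... | l , refl = ∈-deduplicateᵇ⁺ (∈-mapMaybe⁺ (linkid p) (∈-allFin l) (linkid-correct p l c))

  correctIds-timely : ∀ {y} → y ∈ correctIds → ∀ p → y ∈ timely p
  correctIds-timely y∈ p with ∈-map⁻ myid y∈
  ... | w , w∈ , refl = correct-timely w (filtered-correct w∈) p

  timely-length : ∀ p → length (timely p) ≤ N
  timely-length p = begin
    length (timely p)                          ≤⟨ length-deduplicate (T? ∘₂ _≡ᵇ_) (mapMaybe (linkid p) (allFin N)) ⟩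
    length (mapMaybe (linkid p) (allFin N))    ≤⟨ length-mapMaybe _ (allFin N) ⟩
    length (allFin N)                          ≡⟨ length-tabulate (λ i → i) ⟩
    N ∎
    where open ≤-Reasoning

  -- Each link contributes at most one timely identifier, and a correct link a correct
  -- one; hence at most t timely identifiers are not those of correct processes.
  timely-faulty : ∀ p → ∑ (timely p) (𝟙 ∘ not ∘ isCorrectId) ≤ t
  timely-faulty p = begin
    ∑ (timely p) f                                ≤⟨ ∑-deduplicateᵇ≤ f (mapMaybe (linkid p) (allFin N)) ⟩
    ∑ (mapMaybe (linkid p) (allFin N)) f          ≡⟨ ∑-mapMaybe (linkid p) f (allFin N) ⟩
    ∑[ l ∈ allFin N ] maybe f 0 (linkid p l)      ≤⟨ ∑-mono (allFin N) per-link ⟩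
    ∑[ l ∈ allFin N ] 𝟙 (not (correct (link p l))) ≡⟨ ∑-links p (𝟙 ∘ not ∘ correct) ⟩
    ∑ (allFin N) (𝟙 ∘ not ∘ correct)              ≤⟨ faulty-count ⟩
    t ∎
    where
    open ≤-Reasoning
    f : ID → ℕ
    f = 𝟙 ∘ not ∘ isCorrectId
    per-link : ∀ l → maybe f 0 (linkid p l) ≤ 𝟙 (not (correct (link p l)))
    per-link l with correct (link p l) in c
    ... | true  = ≤-reflexive (𝟙-not (correctId⁺ (link p l) (subst T (sym c) _)))
    ... | false = maybe-𝟙≤1 (not ∘ isCorrectId) (byzID (link p l) p)

  -- The timely set of a correct process w and that of any process p share the
  -- identifiers of all correct processes, hence at least N - t identifiers.
  timely-overlap : ∀ p w → T (correct w) → M ≤ inter (timely p) (timely w)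
  timely-overlap p w c = begin
    M                                    ≤⟨ correctIds-length ⟩
    length correctIds                    ≡⟨ length-∑ correctIds ⟩
    ∑[ _ ∈ correctIds ] 1                ≡⟨ ∑-cong correctIds (λ y∈ → sym (when-T 1 (∈⇒∈ᵇ (correctIds-timely y∈ p)))) ⟩
    ∑ correctIds f                       ≤⟨ ∑-⊆ _≟_ f correctIds-unique (λ y∈ → inj₂ (correctIds-timely y∈ w)) ⟩
    ∑ (timely w) f                       ≡⟨ count-∑ (_∈ᵇ timely p) (timely w) ⟨
    inter (timely p) (timely w) ∎
    where
    open ≤-Reasoning
    f : ID → ℕ
    f = 𝟙 ∘ (_∈ᵇ timely p)

  correct-accepted : ∀ p l → T (correct (link p l)) → T (acceptMsg p l (timely (link p l)))
  correct-accepted p l c = Equivalence.from T-∧ (defined , Equivalence.from T-∧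
    (≤⇒≤ᵇ (timely-length (link p l)) , ≤⇒≤ᵇ (timely-overlap p (link p l) c)))
    where
    defined : T (isDefined (linkid p l))
    defined = subst (T ∘ isDefined) (sym (linkid-correct p l c)) _

  acceptedMsg-correct : ∀ p l → T (correct (link p l)) → acceptedMsg p l ≡ just (timely (link p l))
  acceptedMsg-correct p l c with received p l | received-correct p l c
  ... | _ | refl with acceptMsg p l (timely (link p l)) | correct-accepted p l c
  ... | true | _ = refl

  acceptedMsg-inv : ∀ p l {ids} → acceptedMsg p l ≡ just ids → received p l ≡ just ids × T (acceptMsg p l ids)
  acceptedMsg-inv p l eq with received p l
  ... | just ids with acceptMsg p l ids in acc
  ... | true with eq
  ... | refl = refl , subst T (sym acc) _

  -- An accepted message contains at most t identifiers that are not timely (it has at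
  -- most N entries, N - t of them timely) and at most t timely identifiers that are
  -- not correct ones; so at most 2t identifiers of non-correct processes.
  accepted-faulty : ∀ p l {ids} → acceptedMsg p l ≡ just ids → ∑ ids (𝟙 ∘ not ∘ isCorrectId) ≤ t + t
  accepted-faulty p l {ids} eq = begin
    ∑ ids f                                          ≡⟨ ∑-split inTimely ids f ⟩
    ∑[ y ∈ ids ] when (inTimely y) (f y) + ∑[ y ∈ ids ] when (not (inTimely y)) (f y)
                                                     ≤⟨ +-mono-≤ faulty-timely faulty-untimely ⟩
    t + t ∎
    where
    open ≤-Reasoning
    f : ID → ℕ
    f = 𝟙 ∘ not ∘ isCorrectId
    inTimely : ID → Bool
    inTimely = _∈ᵇ timely p
    ids! : Unique ids
    ids! = received-set p l (proj₁ (acceptedMsg-inv p l eq))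
    tests : T (length ids ≤ᵇ N) × T (M ≤ᵇ inter (timely p) ids)
    tests = Equivalence.to T-∧
      (proj₂ (Equivalence.to (T-∧ {isDefined (linkid p l)}) (proj₂ (acceptedMsg-inv p l eq))))
    faulty-timely : ∑[ y ∈ ids ] when (inTimely y) (f y) ≤ t
    faulty-timely = begin
      ∑[ y ∈ ids ] when (inTimely y) (f y)            ≡⟨ ∑-cong ids (λ {y} _ → when-comm (inTimely y) (not (isCorrectId y)) 1) ⟩
      ∑[ y ∈ ids ] when (not (isCorrectId y)) (𝟙 (inTimely y)) ≤⟨ ∑-∩≤ (not ∘ isCorrectId) (timely p) ids! ⟩
      ∑ (timely p) f                                  ≤⟨ timely-faulty p ⟩
      t ∎
    untimely : ∑ ids (𝟙 ∘ not ∘ inTimely) ≤ t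
    untimely = complement≤ t (count-complement inTimely ids) (≤ᵇ⇒≤ _ _ (proj₁ tests))
      (subst (M ≤_) (count-∑ inTimely ids) (≤ᵇ⇒≤ _ _ (proj₂ tests)))
    faulty-untimely : ∑[ y ∈ ids ] when (not (inTimely y)) (f y) ≤ t
    faulty-untimely = ≤-trans (∑-mono ids (λ y → ≤-trans (≤-reflexive (when-comm (not (inTimely y)) _ 1))
      (when≤ (not (isCorrectId y)) (𝟙 (not (inTimely y)))))) untimely

  echo : Fin N → ID → Fin N → ℕ
  echo p y l = maybe (λ ids → 𝟙 (y ∈ᵇ ids)) 0 (acceptedMsg p l)

  correctEchoes : ID → ℕ
  correctEchoes y = ∑[ w ∈ allFin N ] when (correct w) (𝟙 (y ∈ᵇ timely w))

  faultyEchoes : Fin N → ID → ℕ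
  faultyEchoes p y = ∑[ l ∈ allFin N ] when (not (correct (link p l))) (echo p y l)

  counter-split : ∀ p y → counter p y ≡ correctEchoes y + faultyEchoes p y
  counter-split p y = begin
    counter p y                                      ≡⟨ count-∑ (y ∈ᵇ_) (acceptedMsgs p) ⟩
    ∑[ ids ∈ acceptedMsgs p ] 𝟙 (y ∈ᵇ ids)          ≡⟨ ∑-mapMaybe (acceptedMsg p) (λ ids → 𝟙 (y ∈ᵇ ids)) (allFin N) ⟩
    ∑ (allFin N) (echo p y)                          ≡⟨ ∑-split (correct ∘ link p) (allFin N) (echo p y) ⟩
    ∑[ l ∈ allFin N ] when (correct (link p l)) (echo p y l) + faultyEchoes p y
      ≡⟨ cong (_+ faultyEchoes p y) (∑-cong (allFin N) (λ {l} _ → when-cong (correct (link p l))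
           (cong (maybe (λ ids → 𝟙 (y ∈ᵇ ids)) 0) ∘ acceptedMsg-correct p l))) ⟩
    ∑[ l ∈ allFin N ] when (correct (link p l)) (𝟙 (y ∈ᵇ timely (link p l))) + faultyEchoes p y
      ≡⟨ cong (_+ faultyEchoes p y) (∑-links p (λ w → when (correct w) (𝟙 (y ∈ᵇ timely w)))) ⟩
    correctEchoes y + faultyEchoes p y ∎
    where open ≡-Reasoning

  -- A correct identifier is echoed by all correct processes, hence at least N - t times.
  correctEchoes-≥ : ∀ y → T (isCorrectId y) → M ≤ correctEchoes y
  correctEchoes-≥ y y∈ = subst (M ≤_) (∑-cong (allFin N) λ {w} _ → when-cong (correct w) λ _ →
    sym (when-T 1 (∈⇒∈ᵇ (correctIds-timely (∈ᵇ⇒∈ {y} correctIds y∈) w)))) correct-count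

  counter-∉ : ∀ p y → y ∉ accepted p → counter p y ≡ 0
  counter-∉ p y y∉ = trans (count-∑ (y ∈ᵇ_) (acceptedMsgs p)) (∑-zero (acceptedMsgs p) λ ids∈ →
    when-¬T 1 λ y∈ᵇ → y∉ (∈-deduplicateᵇ⁺ (∈-concatMap⁺ (λ ids → ids) (Any.map (λ { refl → ∈ᵇ⇒∈ _ y∈ᵇ }) ids∈))))

  weight : Fin N → ID → ℕ
  weight p y = counter p y ⊓ M

  below : Fin N → ID → List ID
  below p x = filterᵇ (_≤ᵇ x) (accepted p)

  below-unique : ∀ p x → Unique (below p x)
  below-unique p x =
    Unique.filter⁺ (T? ∘ (_≤ᵇ x)) (deduplicateᵇ-unique (concatMap (λ ids → ids) (acceptedMsgs p)))

  -- How much p can overweight a non-correct identifier relative to any other process.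
  excess : Fin N → ID → ℕ
  excess p y = when (not (isCorrectId y)) (faultyEchoes p y)

  -- Correct identifiers get the full weight N - t everywhere; the weights of any other
  -- identifier differ only through echoes from Byzantine processes.
  weight-compare : ∀ p q y → weight p y ≤ weight q y + excess p y
  weight-compare p q y with isCorrectId y in isCorrect
  ... | true = begin
    weight p y     ≤⟨ m⊓n≤n (counter p y) M ⟩
    M              ≡⟨ m≥n⇒m⊓n≡n full ⟨
    weight q y     ≡⟨ +-identityʳ (weight q y) ⟨
    weight q y + 0 ∎
    where
    open ≤-Reasoning
    full : M ≤ counter q y
    full = subst (M ≤_) (sym (counter-split q y))
      (≤-trans (correctEchoes-≥ y (subst T (sym isCorrect) _)) (m≤m+n _ _))
  ... | false rewrite counter-split p y | counter-split q y =
    ⊓-shift (correctEchoes y) (faultyEchoes p y) (faultyEchoes q y) M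

  -- Identifiers that q did not accept have weight 0 at q.
  newid-restrict : ∀ p q x → ∑ (below p x) (weight q) ≤ newid q x
  newid-restrict p q x = ∑-⊆ _≟_ (weight q) (below-unique p x) supp
    where
    supp : ∀ {y} → y ∈ below p x → weight q y ≡ 0 ⊎ y ∈ below q x
    supp {y} y∈ with y ∈? accepted q
    ... | yes y∈acc = inj₂ (∈-filter⁺ (T? ∘ (_≤ᵇ x)) y∈acc (proj₂ (∈-filter⁻ (T? ∘ (_≤ᵇ x)) {xs = accepted p} y∈)))
    ... | no  y∉acc = inj₁ (cong (_⊓ M) (counter-∉ q y y∉acc))

  echoes-faulty : ∀ p l {S} → Unique S → ∑[ y ∈ S ] when (not (isCorrectId y)) (echo p y l) ≤ t + t
  echoes-faulty p l {S} S! with acceptedMsg p l in accepted≡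
  ... | nothing  = ≤-trans (≤-reflexive (∑-zero S λ {y} _ → when-zero (not (isCorrectId y)))) z≤n
  ... | just ids = ≤-trans (∑-∩≤ (not ∘ isCorrectId) ids S!) (accepted-faulty p l accepted≡)

  -- At most t Byzantine links, each contributing at most 2t excess.
  excess-total : ∀ p x → ∑ (below p x) (excess p) ≤ 2 * (t * t)
  excess-total p x = begin
    ∑[ y ∈ below p x ] when (not (isCorrectId y)) (faultyEchoes p y)
      ≡⟨ ∑-swap-when (not ∘ isCorrectId) (not ∘ correct ∘ link p) (echo p) (below p x) (allFin N) ⟩
    ∑[ l ∈ allFin N ] when (not (correct (link p l))) (∑[ y ∈ below p x ] when (not (isCorrectId y)) (echo p y l))
      ≤⟨ ∑-mono (allFin N) (λ l → when-monoʳ (not (correct (link p l))) (echoes-faulty p l (below-unique p x))) ⟩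
    ∑[ l ∈ allFin N ] when (not (correct (link p l))) (t + t)
      ≡⟨ ∑-when-const (not ∘ correct ∘ link p) (t + t) (allFin N) ⟩
    ∑[ l ∈ allFin N ] 𝟙 (not (correct (link p l))) * (t + t)
      ≡⟨ cong (_* (t + t)) (∑-links p (𝟙 ∘ not ∘ correct)) ⟩
    ∑ (allFin N) (𝟙 ∘ not ∘ correct) * (t + t)
      ≤⟨ *-monoˡ-≤ (t + t) faulty-count ⟩
    t * (t + t)
      ≡⟨ *-distribˡ-+ t t t ⟩
    t * t + t * t
      ≡⟨ cong (t * t +_) (+-identityʳ (t * t)) ⟨
    2 * (t * t) ∎
    where open ≤-Reasoning

  newid-compare : ∀ p q x → newid p x ≤ newid q x + 2 * (t * t)
  newid-compare p q x = begin
    ∑ (below p x) (weight p)                      ≤⟨ ∑-mono (below p x) (weight-compare p q) ⟩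
    ∑[ y ∈ below p x ] (weight q y + excess p y)  ≡⟨ ∑-+ (below p x) (weight q) (excess p) ⟩
    ∑ (below p x) (weight q) + ∑ (below p x) (excess p)
                                                  ≤⟨ +-mono-≤ (newid-restrict p q x) (excess-total p x) ⟩
    newid q x + 2 * (t * t) ∎
    where open ≤-Reasoning

-- Comparing in both directions bounds the absolute difference.
lemma10 : (N t : ℕ) → 2 * (t * t) + t < N → (E : Execution N t)
          → (r : Fin N) → T (Execution.correct E r)
          → (p q : Fin N) → T (Execution.correct E p) → T (Execution.correct E q)
          → ∣ AlgorithmB.newid E p (Execution.myid E r) - AlgorithmB.newid E q (Execution.myid E r) ∣ ≤ 2 * (t * t)
lemma10 N t _ E r _ p q _ _ = ∣-∣≤ (newid-compare p q (myid r)) (newid-compare q p (myid r))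
  where
  open Execution E using (myid)
  open Analysis E using (newid-compare)
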